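{- Flat spectra of a Boolean function of degree greater than $2$ with respect to $\{I,H\}^n$ need not be obtainable by pivoting: there exist $n$, a Boolean function $p:\mathrm{GF}(2)^n\to\mathrm{GF}(2)$ and a transform $U\in\{I,H\}^n$, $U\ne I^{\otimes n}$, such that $U(-1)^p$ is flat but $U(-1)^p$ cannot be obtained from $p$ via any sequence of pivot operations. For instance, for $n=6$, $p=x_0x_1x_2+x_0x_1x_3+x_0x_1x_5+x_0x_2x_4+x_0x_2x_5+x_0x_3x_4+x_0x_3x_5+x_0x_4x_5+x_1x_2x_3+x_1x_2x_4+x_1x_2x_5+x_1x_3x_4+x_1x_4x_5+x_2x_3x_4+x_2x_3x_5+x_3x_4x_5$ and $U=H^{\otimes 6}$.
   Context: $(-1)^p\in\mathbb C^{2^n}$ has entries $(-1)^{p(x)}$; a vector is flat if all entries have absolute value $1$. $H=\frac1{\sqrt2}\begin{pmatrix}1&1\\1&-1\end{pmatrix}$, $I$ the $2\times2$ identity, $\{I,H\}^n$ the $n$-fold tensor products of matrices from $\{I,H\}$. Pivot: for a Boolean function $q$ and $i\ne j$ such that $x_ix_j$ is a term of the algebraic normal form of $q$ and no other term of $q$ is divisible by $x_ix_j$, write $q=x_ix_j+x_i\mathcal N_i+x_j\mathcal N_j+R$ with $\mathcal N_i,\mathcal N_j,R$ independent of $x_i,x_j$; the pivot is $q_{iji}=x_ix_j+x_i\mathcal N_j+x_j\mathcal N_i+\mathcal N_i\mathcal N_j+R$, and it satisfies $(-1)^{q_{iji}}=H_iH_j(-1)^q$ where $H_k$ is $H$ in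 the factor of $x_k$ and $I$ elsewhere. -}

module Defs where

open import Data.Bool using (Bool; true; false; _xor_; _∧_; if_then_else_)
open import Data.Nat using (ℕ; zero; suc)
open import Data.Fin using (Fin; #_)
open import Data.Vec using (Vec; []; _∷_; lookup; _[_]≔_; count)
open import Data.Integer using (ℤ; +_; -_; _+_; _*_; _<_; 0ℤ; 1ℤ)
open import Data.Integer using () renaming (_^_ to _^ℤ_)
open import Data.Product using (_×_; ∃; ∃-syntax)
open import Relation.Nullary using (¬_)
open import Relation.Unary using (_∈_)
open import Relation.Binary.PropositionalEquality using (_≡_; _≢_)
open import Relation.Binary.Construct.Closure.ReflexiveTransitive using (Star)

Point : ℕ → Set
Point n = Vec Bool n

BoolFun : ℕ → Set
BoolFun n = Point n → Bool

-- Complex-valued vectors indexed by GF(2)^n, restricted to integer entries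
-- (all vectors occurring below are integer multiples of 2^{-k/2}).
IntVec : ℕ → Set
IntVec n = Point n → ℤ

sgn : Bool → ℤ
sgn false = 1ℤ
sgn true  = - 1ℤ

signVec : ∀ {n} → BoolFun n → IntVec n
signVec p x = sgn (p x)

-- A monomial is a subset m ⊆ {0..n-1}, encoded as a Vec Bool n
-- (m_i = true iff x_i occurs).  anf f m is the ANF coefficient of the
-- monomial m in f (binary Möbius transform: XOR of f(y) over y ⊆ m).

Monomial : ℕ → Set
Monomial n = Vec Bool n

anf : ∀ {n} → BoolFun n → Monomial n → Bool
anf {zero}  f []          = f []
anf {suc n} f (false ∷ m) = anf (λ y → f (false ∷ y)) m
anf {suc n} f (true  ∷ m) = anf (λ y → f (false ∷ y)) m xor anf (λ y → f (true ∷ y)) m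

none : ∀ {n} → Vec Bool n
none {zero}  = []
none {suc n} = false ∷ none

mono2 : ∀ {n} → Fin n → Fin n → Monomial n
mono2 i j = (none [ i ]≔ true) [ j ]≔ true

Divisible : ∀ {n} → Monomial n → Fin n → Fin n → Set
Divisible m i j = (lookup m i ≡ true) × (lookup m j ≡ true)

IndepOf : ∀ {n} → BoolFun n → Fin n → Set
IndepOf g k = ∀ x b → g (x [ k ]≔ b) ≡ g x

record PivotAt {n} (i j : Fin n) (q q' : BoolFun n) : Set where
  field
    i≢j      : i ≢ j
    term     : anf q (mono2 i j) ≡ true
    no-other : ∀ m → Divisible m i j → m ≢ mono2 i j → anf q m ≡ false
    Ni Nj R  : BoolFun n
    Ni-i : IndepOf Ni i
    Ni-j : IndepOf Ni j
    Nj-i : IndepOf Nj i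
    Nj-j : IndepOf Nj j
    R-i  : IndepOf R i
    R-j  : IndepOf R j
    decomp : ∀ x → q x ≡ ((lookup x i ∧ lookup x j) xor (lookup x i ∧ Ni x))
                          xor ((lookup x j ∧ Nj x) xor R x)
    pivot  : ∀ x → q' x ≡ ((lookup x i ∧ lookup x j) xor (lookup x i ∧ Nj x))
                          xor ((lookup x j ∧ Ni x) xor ((Ni x ∧ Nj x) xor R x))

Pivot : ∀ {n} → BoolFun n → BoolFun n → Set
Pivot q q' = ∃[ i ] ∃[ j ] PivotAt i j q q'

PivotReach : ∀ {n} → BoolFun n → BoolFun n → Set
PivotReach = Star Pivot

-- Transforms U ∈ {I,H}^n, encoded as u : Vec Bool n (u_k = true iff the
-- k-th tensor factor, acting on x_k, is H).  With Ĥ = √2·H = [[1,1],[1,-1]],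
-- we have U = 2^{-k/2} · Û where k = count of H factors and Û is the
-- tensor product of I's and Ĥ's; applyU computes Û (integer valued).

Transform : ℕ → Set
Transform n = Vec Bool n

numH : ∀ {n} → Transform n → ℕ
numH {zero}  []          = 0
numH {suc n} (false ∷ u) = numH u
numH {suc n} (true  ∷ u) = suc (numH u)

applyU : ∀ {n} → Transform n → IntVec n → IntVec n
applyU {zero}  []          v []      = v []
applyU {suc n} (false ∷ u) v (a ∷ x) = applyU u (λ y → v (a ∷ y)) x
applyU {suc n} (true  ∷ u) v (a ∷ x) =
  applyU u (λ y → v (false ∷ y)) x + sgn a * applyU u (λ y → v (true ∷ y)) x

IsIdentity : ∀ {n} → Transform n → Set
IsIdentity u = u ≡ none

-- The real number  m · 2^{-k/2}  has absolute value 1.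
AbsOne : ℕ → ℤ → Set
AbsOne k m = m * m ≡ + (2 Data.Nat.^ k)

-- The real number  m · 2^{-k/2}  equals (-1)^b.
EqSign : ℕ → ℤ → Bool → Set
EqSign k m b = AbsOne k m × (0ℤ < sgn b * m)

FlatSpectrum : ∀ {n} → Transform n → BoolFun n → Set
FlatSpectrum u p = ∀ x → AbsOne (numH u) (applyU u (signVec p) x)

TransformEq : ∀ {n} → Transform n → BoolFun n → BoolFun n → Set
TransformEq u p q = ∀ x → EqSign (numH u) (applyU u (signVec p) x) (q x)

pEx : BoolFun 6
pEx x =
    (a ∧ b ∧ c)
  xor (a ∧ b ∧ d)
  xor (a ∧ b ∧ f)
  xor (a ∧ c ∧ e)
  xor (a ∧ c ∧ f)
  xor (a ∧ d ∧ e)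
  xor (a ∧ d ∧ f)
  xor (a ∧ e ∧ f)
  xor (b ∧ c ∧ d)
  xor (b ∧ c ∧ e)
  xor (b ∧ c ∧ f)
  xor (b ∧ d ∧ e)
  xor (b ∧ e ∧ f)
  xor (c ∧ d ∧ e)
  xor (c ∧ d ∧ f)
  xor (d ∧ e ∧ f)
  where
  a = lookup x (# 0)
  b = lookup x (# 1)
  c = lookup x (# 2)
  d = lookup x (# 3)
  e = lookup x (# 4)
  f = lookup x (# 5)

uEx : Transform 6
uEx = true ∷ true ∷ true ∷ true ∷ true ∷ true ∷ []

-- Every quadratic ANF coefficient of pEx vanishes, so no pivot applies to pEx
-- and the only function pivot-reachable from it is pEx itself.  On the other
-- hand pEx is bent: H^{⊗6}(-1)^pEx is flat, yet it differs from (-1)^pEx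
-- (already at x = 001011).
module Submission where

open import Defs
open import Data.Bool using (true; false)
open import Data.Bool.Properties using () renaming (_≟_ to _≟ᵇ_)
open import Data.Empty using (⊥-elim)
open import Data.Fin.Properties using (all?)
open import Data.Integer using (_<?_) renaming (_≟_ to _≟ℤ_)
open import Data.Nat using (ℕ; zero; suc)
open import Data.Product using (Σ; _×_; ∃-syntax; _,_)
open import Data.Vec using ([]; _∷_)
open import Function using (_∘_)
open import Relation.Binary.Construct.Closure.ReflexiveTransitive using (ε; _◅_)
open import Relation.Binary.PropositionalEquality using (_≡_; refl; trans; sym)
open import Relation.Nullary using (¬_; Dec; map′; _×-dec_; toWitness; toWitnessFalse)
open import Relation.Unary using (Pred; Decidable)

allPoints? : ∀ {n ℓ} {P : Pred (Point n) ℓ} → Decidable P → Dec (∀ x → P x)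
allPoints? {zero}  P? = map′ (λ { p [] → p }) (λ p → p []) (P? [])
allPoints? {suc n} P? =
  map′ (λ { (p₀ , p₁) (false ∷ x) → p₀ x ; (p₀ , p₁) (true ∷ x) → p₁ x })
       (λ p → p ∘ (false ∷_) , p ∘ (true ∷_))
       (allPoints? (P? ∘ (false ∷_)) ×-dec allPoints? (P? ∘ (true ∷_)))

flatSpectrum? : ∀ {n} (u : Transform n) (p : BoolFun n) → Dec (FlatSpectrum u p)
flatSpectrum? u p = allPoints? λ x → _ ≟ℤ _

transformEq? : ∀ {n} (u : Transform n) (p q : BoolFun n) → Dec (TransformEq u p q)
transformEq? u p q = allPoints? λ x → (_ ≟ℤ _) ×-dec (_ <? _)

NoQuadraticTerms : ∀ {n} → BoolFun n → Set
NoQuadraticTerms q = ∀ i j → anf q (mono2 i j) ≡ false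

noQuadraticTerms? : ∀ {n} (q : BoolFun n) → Dec (NoQuadraticTerms q)
noQuadraticTerms? q = all? λ i → all? λ j → anf q (mono2 i j) ≟ᵇ false

noQuadraticTerms⇒¬pivot : ∀ {n} {q q′ : BoolFun n} → NoQuadraticTerms q → ¬ Pivot q q′
noQuadraticTerms⇒¬pivot noQuad (i , j , r) with trans (sym (PivotAt.term r)) (noQuad i j)
... | ()

pivotReach-stuck : ∀ {n} {q q′ : BoolFun n} →
                   (∀ {q″} → ¬ Pivot q q″) → PivotReach q q′ → q ≡ q′
pivotReach-stuck stuck ε       = refl
pivotReach-stuck stuck (s ◅ _) = ⊥-elim (stuck s)

uEx-nonIdentity : ¬ IsIdentity uEx
uEx-nonIdentity ()

pEx-flat : FlatSpectrum uEx pEx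
pEx-flat = toWitness {a? = flatSpectrum? uEx pEx} _

pEx-not-fixed : ¬ TransformEq uEx pEx pEx
pEx-not-fixed = toWitnessFalse {a? = transformEq? uEx pEx pEx} _

pEx-noQuadraticTerms : NoQuadraticTerms pEx
pEx-noQuadraticTerms = toWitness {a? = noQuadraticTerms? pEx} _

pEx-unreachable : ∀ q → PivotReach pEx q → ¬ TransformEq uEx pEx q
pEx-unreachable q reach with pivotReach-stuck (noQuadraticTerms⇒¬pivot pEx-noQuadraticTerms) reach
... | refl = pEx-not-fixed

lemma3 : (Σ ℕ λ n → Σ (BoolFun n) λ p → Σ (Transform n) λ u →
              ¬ IsIdentity u × FlatSpectrum u p
              × (∀ q → PivotReach p q → ¬ TransformEq u p q))
           × (¬ IsIdentity uEx × FlatSpectrum uEx pEx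
              × (∀ q → PivotReach pEx q → ¬ TransformEq uEx pEx q))
lemma3 = (6 , pEx , uEx , example) , example
  where
  example : ¬ IsIdentity uEx × FlatSpectrum uEx pEx
            × (∀ q → PivotReach pEx q → ¬ TransformEq uEx pEx q)
  example = uEx-nonIdentity , pEx-flat , pEx-unreachable
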